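{- Let $\mathcal A$ be an associative unital $\mathbb C$-algebra, $A,B\in\mathcal A$, and $\lambda,\epsilon\in\mathbb C$ both nonzero. Then the following are equivalent: (i) $[B,A]=\epsilon A-\lambda A^2$; (ii) for all $n\in\mathbb N$, \[ (A+B)^n=\sum_{k=0}^n\binom{n}{k}\Big(\sum_{j=0}^k {k\brace j}\epsilon^{k-j}[\lambda]_jA^j\Big)B^{n-k}=\sum_{k=0}^n\epsilon^{n-k}\sum_{j=0}^k\binom{n}{j}{n-j\brace k-j}[\lambda]_{k-j}A^{k-j}B^j; \] (iii) for all $t$, $e^{(A+B)t}=\Big(1+\lambda A\frac{e^{\epsilon t}-1}{\epsilon}\Big)^{1/\lambda}e^{Bt}$.
   Context: $[X,Y]=XY-YX$; $e^X=\sum_{n\ge0}X^n/n!$. ${n\brace k}$ denotes the Stirling numbers of the second kind, defined by $x^n=\sum_{k=0}^n{n\brace k}x(x-1)\cdots(x-k+1)$ (and $0$ for $k\notin\{0,\dots,n\}$). $[x]_n:=\prod_{i=1}^{n-1}(1-ix)$ (empty product $=1$). For $X$ a formal series in $t$ with coefficients in $\mathcal A$ and scalar $\mu$, $X^\mu:=\sum_{k\ge0}(X-1)^k\binom{\mu}{k}$. Series are treated formally; identities in $t$ are equalities of formal power series in $t$. -}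

module Defs where

open import Level using (Level; _⊔_) renaming (suc to lsuc)
open import Data.Nat using (ℕ; zero; suc; _∸_; _!)
open import Data.Nat.Combinatorics using (_C_)
open import Relation.Nullary using (¬_)
open import Algebra.Bundles using (CommutativeRing; Ring)
open import Algebra.Morphism.Structures using (IsRingHomomorphism)

module RingOps {c ℓ : Level} (R : Ring c ℓ) where
  open Ring R

  sumBelow : ℕ → (ℕ → Carrier) → Carrier
  sumBelow zero    f = 0#
  sumBelow (suc n) f = sumBelow n f + f n

  sumTo : ℕ → (ℕ → Carrier) → Carrier
  sumTo n f = sumBelow (suc n) f

  prodBelow : ℕ → (ℕ → Carrier) → Carrier
  prodBelow zero    f = 1#
  prodBelow (suc n) f = prodBelow n f * f n

  pow : Carrier → ℕ → Carrier
  pow x zero    = 1#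
  pow x (suc n) = pow x n * x

  fromℕ : ℕ → Carrier
  fromℕ zero    = 0#
  fromℕ (suc n) = 1# + fromℕ n

-- Fields of characteristic zero (stand-in for ℂ)

record CharZeroField (c ℓ : Level) : Set (lsuc (c ⊔ ℓ)) where
  field
    commutativeRing : CommutativeRing c ℓ
  open CommutativeRing commutativeRing public
  open RingOps ring public
  field
    _⁻¹      : Carrier → Carrier
    inverseʳ : ∀ x → ¬ (x ≈ 0#) → (x * (x ⁻¹)) ≈ 1#
    charZero : ∀ n → ¬ (fromℕ (suc n) ≈ 0#)

-- Associative unital K-algebras: a ring 𝒜 with a ring homomorphism
-- ι : K → 𝒜 whose image is central (scalar c acts as ι c * _).

record Algebra {c ℓ : Level} (K : CharZeroField c ℓ) (a ℓa : Level)
       : Set (c ⊔ ℓ ⊔ lsuc (a ⊔ ℓa)) where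
  private module K = CharZeroField K
  field
    ring    : Ring a ℓa
  open Ring ring public
  open RingOps ring public
  field
    ι       : K.Carrier → Carrier
    ι-hom   : IsRingHomomorphism K.rawRing rawRing ι
    ι-central : ∀ k x → (ι k * x) ≈ (x * ι k)

stirling2 : ℕ → ℕ → ℕ
stirling2 zero    zero    = 1
stirling2 zero    (suc k) = 0
stirling2 (suc n) zero    = 0
stirling2 (suc n) (suc k) = suc k Data.Nat.* stirling2 n (suc k) Data.Nat.+ stirling2 n k

module FieldOps {c ℓ : Level} (K : CharZeroField c ℓ) where
  open CharZeroField K

  -- [x]_n = ∏_{i=1}^{n-1} (1 - i x)  (empty product = 1)
  bracket : Carrier → ℕ → Carrier
  bracket x zero    = 1#
  bracket x (suc n) = prodBelow n (λ i → 1# - fromℕ (suc i) * x)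

  gbinom : Carrier → ℕ → Carrier
  gbinom μ k = prodBelow k (λ i → μ - fromℕ i) * (fromℕ (k !) ⁻¹)

  expK : Carrier → ℕ → Carrier
  expK x n = pow x n * (fromℕ (n !) ⁻¹)

module Series {c ℓ a ℓa : Level} {K : CharZeroField c ℓ} (𝒜 : Algebra K a ℓa) where
  private module K = CharZeroField K
  open FieldOps K
  open Algebra 𝒜

  PS : Set a
  PS = ℕ → Carrier

  _≋_ : PS → PS → Set ℓa
  X ≋ Y = ∀ n → X n ≈ Y n

  constS : Carrier → PS
  constS x zero    = x
  constS x (suc n) = 0#

  _⊕_ : PS → PS → PS
  (X ⊕ Y) n = X n + Y n

  _⊖_ : PS → PS → PS
  (X ⊖ Y) n = X n - Y n

  _⊛_ : PS → PS → PS
  (X ⊛ Y) n = sumTo n (λ i → X i * Y (n ∸ i))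

  powS : PS → ℕ → PS
  powS X zero    = constS 1#
  powS X (suc k) = powS X k ⊛ X

  liftS : (ℕ → K.Carrier) → PS
  liftS f n = ι (f n)

  expS : Carrier → PS
  expS X n = ι (K.fromℕ (n !) K.⁻¹) * pow X n

  -- For X with constant term 1 the
  -- coefficient of t^n only receives contributions from k ≤ n, since
  -- (X-1)^k has no terms below t^k; this is the formal meaning of the sum.
  powμ : PS → K.Carrier → PS
  powμ X μ n = sumTo n (λ k → powS (X ⊖ constS 1#) k n * ι (gbinom μ k))

-- Let P_k = Σ_j S(k,j) ε^{k-j} [λ]_j A^j. Under [B,A] = εA - λA² one has
-- B A^j = A^j B + jε A^j - jλ A^{j+1}, and together with the Stirling recurrence
-- S(k+1,j+1) = (j+1) S(k,j+1) + S(k,j) and [λ]_{j+1} = [λ]_j (1 - jλ) this gives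
-- (A+B) P_k = P_k B + P_{k+1}; Pascal's rule then yields (A+B)^n = Σ_k C(n,k) P_k B^{n-k}.
-- The second double sum in (ii) is the same sum over the triangle a + b ≤ n, read along
-- antidiagonals, and the case n = 2 of (ii) is exactly the commutation relation.
-- For (iii), X - 1 = (λ/ε)(e^{εt} - 1) A; the generating function
-- (e^{εt} - 1)^m = m! Σ_n S(n,m) ε^n t^n/n! and λ^m m! binom(1/λ, m) = [λ]_m give
-- X^{1/λ} = Σ_k P_k t^k/k!, so the t^n-coefficient of X^{1/λ} e^{Bt} is (ii)'s first sum
-- divided by n!, and (iii) is equivalent to the first identity of (ii) for all n.

module Submission where

open import Defs
open import Data.Nat using (ℕ; _∸_)
open import Data.Nat.Combinatorics using (_C_)
open import Data.Product using (_×_)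
open import Relation.Nullary using (¬_)
open import Function.Bundles using (_⇔_)

open import Level using (Level)
open import Algebra.Bundles using (Ring; CommutativeRing)
open import Algebra.Morphism.Structures using (IsRingHomomorphism)
import Algebra.Morphism.Construct.Identity as Identity
open import Data.Nat as ℕ using (zero; suc; _≤_; _<_; z≤n; s≤s; _!)
import Data.Nat.Properties as ℕ
open import Data.Nat.Combinatorics
  using (k>n⇒nCk≡0; nCk+nC[k+1]≡[n+1]C[k+1]; nCk≡n!/k![n-k]!; k![n∸k]!∣n!; nCn≡1; nCk≡nC[n∸k])
open import Data.Nat.DivMod using (m/n*n≡m)
open import Data.Product using (_,_; proj₁)
open import Data.Sum using (inj₁; inj₂)
open import Function using (id)
open import Function.Bundles using (mk⇔)
open import Relation.Binary.PropositionalEquality as ≡ using (_≡_)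

[m∸o]∸[n∸o]≡m∸n : ∀ {m n o} → o ≤ n → n ≤ m → (m ∸ o) ∸ (n ∸ o) ≡ m ∸ n
[m∸o]∸[n∸o]≡m∸n z≤n       _         = ≡.refl
[m∸o]∸[n∸o]≡m∸n (s≤s o≤n) (s≤s n≤m) = [m∸o]∸[n∸o]≡m∸n o≤n n≤m

nCk*k!*[n∸k]!≡n! : ∀ {n k} → k ≤ n → (n C k) ℕ.* (k ! ℕ.* (n ∸ k) !) ≡ n !
nCk*k!*[n∸k]!≡n! {n} {k} k≤n =
  ≡.trans (≡.cong (ℕ._* (k ! ℕ.* (n ∸ k) !)) (nCk≡n!/k![n-k]! k≤n))
          (m/n*n≡m {{ℕ._!*_!≢0 k (n ∸ k)}} (k![n∸k]!∣n! k≤n))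

stirling2-vanish : ∀ {k j} → k < j → stirling2 k j ≡ 0
stirling2-vanish {zero}  {suc j} _         = ≡.refl
stirling2-vanish {suc k} {suc j} (s≤s k<j)
  rewrite stirling2-vanish (ℕ.m≤n⇒m≤1+n k<j) | stirling2-vanish k<j = ≡.trans (ℕ.+-identityʳ _) (ℕ.*-zeroʳ j)

stirling2-diagonal : ∀ k → stirling2 k k ≡ 1
stirling2-diagonal zero    = ≡.refl
stirling2-diagonal (suc k) rewrite stirling2-vanish (ℕ.n<1+n k) | stirling2-diagonal k = ≡.cong (ℕ._+ 1) (ℕ.*-zeroʳ k)

module RingSums {c ℓ : Level} (R : Ring c ℓ) where
  open Ring R
  open RingOps R
  open import Relation.Binary.Reasoning.Setoid setoid
  open import Algebra.Properties.CommutativeSemigroup +-commutativeSemigroup using (interchange)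
  open import Algebra.Properties.Semiring.Mult semiring using (×-homo-+; ×1-homo-*) renaming (_×_ to _·_)

  sumBelow-cong-< : ∀ n {f g : ℕ → Carrier} → (∀ i → i < n → f i ≈ g i) → sumBelow n f ≈ sumBelow n g
  sumBelow-cong-< zero    f≈g = refl
  sumBelow-cong-< (suc n) f≈g = +-cong (sumBelow-cong-< n (λ i i<n → f≈g i (ℕ.m≤n⇒m≤1+n i<n))) (f≈g n ℕ.≤-refl)

  sumBelow-cong : ∀ n {f g : ℕ → Carrier} → (∀ i → f i ≈ g i) → sumBelow n f ≈ sumBelow n g
  sumBelow-cong n f≈g = sumBelow-cong-< n (λ i _ → f≈g i)

  sumTo-cong-≤ : ∀ n {f g : ℕ → Carrier} → (∀ i → i ≤ n → f i ≈ g i) → sumTo n f ≈ sumTo n g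
  sumTo-cong-≤ n f≈g = sumBelow-cong-< (suc n) (λ i i≤n → f≈g i (ℕ.≤-pred i≤n))

  sumBelow-+ : ∀ n (f g : ℕ → Carrier) → sumBelow n (λ i → f i + g i) ≈ sumBelow n f + sumBelow n g
  sumBelow-+ zero    f g = sym (+-identityˡ 0#)
  sumBelow-+ (suc n) f g = trans (+-congʳ (sumBelow-+ n f g)) (interchange _ _ _ _)

  *-distribˡ-sumBelow : ∀ n x (f : ℕ → Carrier) → x * sumBelow n f ≈ sumBelow n (λ i → x * f i)
  *-distribˡ-sumBelow zero    x f = zeroʳ x
  *-distribˡ-sumBelow (suc n) x f = trans (distribˡ _ _ _) (+-congʳ (*-distribˡ-sumBelow n x f))

  *-distribʳ-sumBelow : ∀ n x (f : ℕ → Carrier) → sumBelow n f * x ≈ sumBelow n (λ i → f i * x)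
  *-distribʳ-sumBelow zero    x f = zeroˡ x
  *-distribʳ-sumBelow (suc n) x f = trans (distribʳ _ _ _) (+-congʳ (*-distribʳ-sumBelow n x f))

  sumBelow-zero : ∀ n (f : ℕ → Carrier) → (∀ i → i < n → f i ≈ 0#) → sumBelow n f ≈ 0#
  sumBelow-zero zero    f f≈0 = refl
  sumBelow-zero (suc n) f f≈0 =
    trans (+-cong (sumBelow-zero n f (λ i i<n → f≈0 i (ℕ.m≤n⇒m≤1+n i<n))) (f≈0 n ℕ.≤-refl)) (+-identityʳ 0#)

  sumBelow-suc-first : ∀ n (f : ℕ → Carrier) → sumBelow (suc n) f ≈ f 0 + sumBelow n (λ i → f (suc i))
  sumBelow-suc-first zero    f = trans (+-identityˡ _) (sym (+-identityʳ _))
  sumBelow-suc-first (suc n) f = trans (+-congʳ (sumBelow-suc-first n f)) (+-assoc _ _ _)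

  sumTo-drop-last : ∀ n (f : ℕ → Carrier) → f n ≈ 0# → sumTo n f ≈ sumBelow n f
  sumTo-drop-last n f fn≈0 = trans (+-congˡ fn≈0) (+-identityʳ _)

  sumTo-only-last : ∀ n (f : ℕ → Carrier) → (∀ i → i < n → f i ≈ 0#) → sumTo n f ≈ f n
  sumTo-only-last n f f≈0 = trans (+-congʳ (sumBelow-zero n f f≈0)) (+-identityˡ _)

  sumTo-only-first : ∀ n (f : ℕ → Carrier) → (∀ i → i < n → f (suc i) ≈ 0#) → sumTo n f ≈ f 0
  sumTo-only-first n f f≈0 =
    trans (sumBelow-suc-first n f) (trans (+-congˡ (sumBelow-zero n _ f≈0)) (+-identityʳ _))

  sumTo-reverse : ∀ n (f : ℕ → Carrier) → sumTo n (λ k → f (n ∸ k)) ≈ sumTo n f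
  sumTo-reverse zero    f = refl
  sumTo-reverse (suc n) f = begin
    sumTo (suc n) (λ k → f (suc n ∸ k))   ≈⟨ sumBelow-suc-first (suc n) _ ⟩
    f (suc n) + sumTo n (λ k → f (n ∸ k)) ≈⟨ +-congˡ (sumTo-reverse n f) ⟩
    f (suc n) + sumTo n f                 ≈⟨ +-comm _ _ ⟩
    sumTo (suc n) f                       ∎

  sumSimplex : ℕ → (ℕ → ℕ → Carrier) → Carrier
  sumSimplex n T = sumTo n (λ b → sumTo (n ∸ b) (λ a → T a b))

  sumSimplex-byReversedColumns : ∀ n T → sumTo n (λ k → sumTo k (λ j → T j (n ∸ k))) ≈ sumSimplex n T
  sumSimplex-byReversedColumns n T = begin
    sumTo n (λ k → sumTo k (λ j → T j (n ∸ k)))               ≈⟨ sumTo-reverse n _ ⟨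
    sumTo n (λ b → sumTo (n ∸ b) (λ j → T j (n ∸ (n ∸ b))))
      ≈⟨ sumTo-cong-≤ n (λ b b≤n → sumBelow-cong (suc (n ∸ b)) (λ j → reflexive (≡.cong (T j) (ℕ.m∸[m∸n]≡n b≤n)))) ⟩
    sumSimplex n T                                            ∎

  sumSimplex-byAntidiagonals : ∀ n T → sumTo n (λ k → sumTo k (λ j → T (k ∸ j) j)) ≈ sumSimplex n T
  sumSimplex-byAntidiagonals zero    T = refl
  sumSimplex-byAntidiagonals (suc n) T = begin
    sumTo n (λ k → sumTo k (λ j → T (k ∸ j) j)) + sumTo (suc n) (λ j → T (suc n ∸ j) j)
      ≈⟨ +-cong (sumSimplex-byAntidiagonals n T) lastDiagonal ⟩
    sumSimplex n T + (sumTo n (λ b → T (suc (n ∸ b)) b) + T 0 (suc n))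
      ≈⟨ +-assoc _ _ _ ⟨
    (sumSimplex n T + sumTo n (λ b → T (suc (n ∸ b)) b)) + T 0 (suc n)
      ≈⟨ +-cong (sym (sumBelow-+ (suc n) _ _)) lastColumn ⟩
    sumTo n (λ b → sumTo (n ∸ b) (λ a → T a b) + T (suc (n ∸ b)) b) + sumTo (n ∸ n) (λ a → T a (suc n))
      ≈⟨ +-congʳ (sumTo-cong-≤ n (λ b b≤n →
           reflexive (≡.cong (λ m → sumTo m (λ a → T a b)) (≡.sym (ℕ.+-∸-assoc 1 b≤n))))) ⟩
    sumSimplex (suc n) T ∎
    where
    lastDiagonal : sumTo (suc n) (λ j → T (suc n ∸ j) j) ≈ sumTo n (λ b → T (suc (n ∸ b)) b) + T 0 (suc n)
    lastDiagonal = +-cong (sumTo-cong-≤ n (λ j j≤n → reflexive (≡.cong (λ m → T m j) (ℕ.+-∸-assoc 1 j≤n))))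
                          (reflexive (≡.cong (λ m → T m (suc n)) (ℕ.n∸n≡0 n)))
    lastColumn : T 0 (suc n) ≈ sumTo (n ∸ n) (λ a → T a (suc n))
    lastColumn = sym (trans (reflexive (≡.cong (λ m → sumTo m (λ a → T a (suc n))) (ℕ.n∸n≡0 n))) (+-identityˡ _))

  sumTo-triangle : ∀ n T →
    sumTo n (λ k → sumTo k (λ j → T j (n ∸ k))) ≈ sumTo n (λ k → sumTo k (λ j → T (k ∸ j) j))
  sumTo-triangle n T = trans (sumSimplex-byReversedColumns n T) (sym (sumSimplex-byAntidiagonals n T))

  fromℕ≈·1# : ∀ n → fromℕ n ≈ n · 1#
  fromℕ≈·1# zero    = refl
  fromℕ≈·1# (suc n) = +-congˡ (fromℕ≈·1# n)

  fromℕ-+ : ∀ m n → fromℕ (m ℕ.+ n) ≈ fromℕ m + fromℕ n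
  fromℕ-+ m n = trans (fromℕ≈·1# (m ℕ.+ n)) (trans (×-homo-+ 1# m n) (sym (+-cong (fromℕ≈·1# m) (fromℕ≈·1# n))))

  fromℕ-* : ∀ m n → fromℕ (m ℕ.* n) ≈ fromℕ m * fromℕ n
  fromℕ-* m n = trans (fromℕ≈·1# (m ℕ.* n)) (trans (×1-homo-* m n) (sym (*-cong (fromℕ≈·1# m) (fromℕ≈·1# n))))

  fromℕ-cong : ∀ {m n} → m ≡ n → fromℕ m ≈ fromℕ n
  fromℕ-cong ≡.refl = refl

  sumTo-pascal : ∀ n (f : ℕ → Carrier) →
    sumTo n (λ k → fromℕ (n C k) * f (suc k)) + sumTo n (λ k → fromℕ (n C k) * f k)
      ≈ sumTo (suc n) (λ k → fromℕ (suc n C k) * f k)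
  sumTo-pascal n f = begin
    Σshift + sumTo n (λ k → fromℕ (n C k) * f k)       ≈⟨ +-congˡ (sumBelow-suc-first n _) ⟩
    Σshift + (f₀ + sumBelow n (λ k → fromℕ (n C suc k) * f (suc k)))
      ≈⟨ +-congˡ (+-congˡ (sumTo-drop-last n (λ k → fromℕ (n C suc k) * f (suc k)) nC[n+1]≈0)) ⟨
    Σshift + (f₀ + Σnext)                               ≈⟨ x∙yz≈y∙xz _ _ _ ⟩
    f₀ + (Σshift + Σnext)                               ≈⟨ +-congˡ (sumBelow-+ (suc n) _ _) ⟨
    f₀ + sumTo n (λ k → fromℕ (n C k) * f (suc k) + fromℕ (n C suc k) * f (suc k))
      ≈⟨ +-congˡ (sumBelow-cong (suc n) (λ k → trans (sym (distribʳ _ _ _)) (*-congʳ (pascalTerm k)))) ⟩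
    f₀ + sumTo n (λ k → fromℕ (suc n C suc k) * f (suc k)) ≈⟨ sumBelow-suc-first (suc n) _ ⟨
    sumTo (suc n) (λ k → fromℕ (suc n C k) * f k)       ∎
    where
    open import Algebra.Properties.CommutativeSemigroup +-commutativeSemigroup using (x∙yz≈y∙xz)
    f₀ Σshift Σnext : Carrier
    f₀ = fromℕ 1 * f 0
    Σshift = sumTo n (λ k → fromℕ (n C k) * f (suc k))
    Σnext = sumTo n (λ k → fromℕ (n C suc k) * f (suc k))
    nC[n+1]≈0 : fromℕ (n C suc n) * f (suc n) ≈ 0#
    nC[n+1]≈0 = trans (*-congʳ (fromℕ-cong (k>n⇒nCk≡0 {n} {suc n} ℕ.≤-refl))) (zeroˡ _)
    pascalTerm : ∀ k → fromℕ (n C k) + fromℕ (n C suc k) ≈ fromℕ (suc n C suc k)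
    pascalTerm k = trans (sym (fromℕ-+ (n C k) (n C suc k))) (fromℕ-cong (nCk+nC[k+1]≡[n+1]C[k+1] n k))

  pow-sucˡ : ∀ x n → x * pow x n ≈ pow x (suc n)
  pow-sucˡ x zero    = trans (*-identityʳ x) (sym (*-identityˡ x))
  pow-sucˡ x (suc n) = trans (sym (*-assoc _ _ _)) (*-congʳ (pow-sucˡ x n))

  pow-+ : ∀ x m n → pow x (m ℕ.+ n) ≈ pow x m * pow x n
  pow-+ x m zero    = trans (reflexive (≡.cong (pow x) (ℕ.+-identityʳ m))) (sym (*-identityʳ _))
  pow-+ x m (suc n) = begin
    pow x (m ℕ.+ suc n)     ≈⟨ reflexive (≡.cong (pow x) (ℕ.+-suc m n)) ⟩
    pow x (m ℕ.+ n) * x     ≈⟨ *-congʳ (pow-+ x m n) ⟩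
    (pow x m * pow x n) * x ≈⟨ *-assoc _ _ _ ⟩
    pow x m * pow x (suc n) ∎

  pow-cong : ∀ {x y} n → x ≈ y → pow x n ≈ pow y n
  pow-cong zero    x≈y = refl
  pow-cong (suc n) x≈y = *-cong (pow-cong n x≈y) x≈y

module CharZeroFieldProperties {c ℓ : Level} (K : CharZeroField c ℓ) where
  open CharZeroField K
  open FieldOps K
  open RingSums ring
  open import Relation.Binary.Reasoning.Setoid setoid
  open import Algebra.Solver.Ring.NaturalCoefficients.Default commutativeSemiring

  inverseˡ : ∀ x → ¬ (x ≈ 0#) → x ⁻¹ * x ≈ 1#
  inverseˡ x x≉0 = trans (*-comm _ _) (inverseʳ x x≉0)

  ⁻¹-unique : ∀ x y → ¬ (x ≈ 0#) → x * y ≈ 1# → y ≈ x ⁻¹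
  ⁻¹-unique x y x≉0 xy≈1 = begin
    y                ≈⟨ *-identityˡ y ⟨
    1# * y           ≈⟨ *-congʳ (inverseˡ x x≉0) ⟨
    (x ⁻¹ * x) * y   ≈⟨ *-assoc _ _ _ ⟩
    x ⁻¹ * (x * y)   ≈⟨ *-congˡ xy≈1 ⟩
    x ⁻¹ * 1#        ≈⟨ *-identityʳ _ ⟩
    x ⁻¹             ∎

  *-nonzero : ∀ x y → ¬ (x ≈ 0#) → ¬ (y ≈ 0#) → ¬ (x * y ≈ 0#)
  *-nonzero x y x≉0 y≉0 xy≈0 = y≉0 (begin
    y                ≈⟨ *-identityˡ y ⟨
    1# * y           ≈⟨ *-congʳ (inverseˡ x x≉0) ⟨
    (x ⁻¹ * x) * y   ≈⟨ *-assoc _ _ _ ⟩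
    x ⁻¹ * (x * y)   ≈⟨ *-congˡ xy≈0 ⟩
    x ⁻¹ * 0#        ≈⟨ zeroʳ _ ⟩
    0#               ∎)

  ⁻¹-distrib-* : ∀ x y → ¬ (x ≈ 0#) → ¬ (y ≈ 0#) → (x * y) ⁻¹ ≈ x ⁻¹ * y ⁻¹
  ⁻¹-distrib-* x y x≉0 y≉0 = sym (⁻¹-unique (x * y) _ (*-nonzero x y x≉0 y≉0) (begin
    (x * y) * (x ⁻¹ * y ⁻¹)
      ≈⟨ solve 4 (λ x y u v → (x :* y) :* (u :* v) := (x :* u) :* (y :* v)) refl x y (x ⁻¹) (y ⁻¹) ⟩
    (x * x ⁻¹) * (y * y ⁻¹)   ≈⟨ *-cong (inverseʳ x x≉0) (inverseʳ y y≉0) ⟩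
    1# * 1#                   ≈⟨ *-identityˡ _ ⟩
    1#                        ∎))

  fromℕ-!-nonzero : ∀ n → ¬ (fromℕ (n !) ≈ 0#)
  fromℕ-!-nonzero n n!≈0 = charZero (ℕ.pred (n !)) (trans (fromℕ-cong (ℕ.suc-pred (n !) {{ℕ._!≢0 n}})) n!≈0)

  fromℕ1⁻¹≈1 : fromℕ 1 ⁻¹ ≈ 1#
  fromℕ1⁻¹≈1 = sym (⁻¹-unique (fromℕ 1) 1# (charZero 0) (trans (*-identityʳ _) (+-identityʳ 1#)))

  factorial⁻¹-* : ∀ n i → i ≤ n → fromℕ (i !) ⁻¹ * fromℕ ((n ∸ i) !) ⁻¹ ≈ fromℕ (n !) ⁻¹ * fromℕ (n C i)
  factorial⁻¹-* n i i≤n = begin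
    a ⁻¹ * b ⁻¹        ≈⟨ ⁻¹-distrib-* a b (fromℕ-!-nonzero i) (fromℕ-!-nonzero (n ∸ i)) ⟨
    (a * b) ⁻¹         ≈⟨ ⁻¹-unique (a * b) _ (*-nonzero a b (fromℕ-!-nonzero i) (fromℕ-!-nonzero (n ∸ i))) ab*rhs≈1 ⟨
    N ⁻¹ * binom       ∎
    where
    a b N binom : Carrier
    a = fromℕ (i !)
    b = fromℕ ((n ∸ i) !)
    N = fromℕ (n !)
    binom = fromℕ (n C i)
    N≈binom*ab : N ≈ binom * (a * b)
    N≈binom*ab = trans (fromℕ-cong (≡.sym (nCk*k!*[n∸k]!≡n! i≤n)))
                       (trans (fromℕ-* (n C i) _) (*-congˡ (fromℕ-* (i !) ((n ∸ i) !))))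
    ab*rhs≈1 : (a * b) * (N ⁻¹ * binom) ≈ 1#
    ab*rhs≈1 = begin
      (a * b) * (N ⁻¹ * binom) ≈⟨ solve 3 (λ x y z → x :* (y :* z) := y :* (z :* x)) refl (a * b) (N ⁻¹) binom ⟩
      N ⁻¹ * (binom * (a * b)) ≈⟨ *-congˡ N≈binom*ab ⟨
      N ⁻¹ * N                 ≈⟨ inverseˡ N (fromℕ-!-nonzero n) ⟩
      1#                       ∎

  pow-* : ∀ x y n → pow (x * y) n ≈ pow x n * pow y n
  pow-* x y zero    = sym (*-identityˡ _)
  pow-* x y (suc n) = trans (*-congʳ (pow-* x y n))
    (solve 4 (λ a b x y → (a :* b) :* (x :* y) := (a :* x) :* (b :* y)) refl _ _ x y)

  pow-1# : ∀ n → pow 1# n ≈ 1#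
  pow-1# zero    = refl
  pow-1# (suc n) = trans (*-identityʳ _) (pow-1# n)

  pow-⁻¹-* : ∀ x → ¬ (x ≈ 0#) → ∀ m k → m ≤ k → pow (x ⁻¹) m * pow x k ≈ pow x (k ∸ m)
  pow-⁻¹-* x x≉0 m k m≤k = begin
    pow (x ⁻¹) m * pow x k                      ≈⟨ *-congˡ (trans (reflexive (≡.cong (pow x) (≡.sym (ℕ.m+[n∸m]≡n m≤k))))
                                                                  (pow-+ x m (k ∸ m))) ⟩
    pow (x ⁻¹) m * (pow x m * pow x (k ∸ m))    ≈⟨ *-assoc _ _ _ ⟨
    (pow (x ⁻¹) m * pow x m) * pow x (k ∸ m)    ≈⟨ *-congʳ (trans (sym (pow-* (x ⁻¹) x m))
                                                            (trans (pow-cong m (inverseˡ x x≉0)) (pow-1# m))) ⟩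
    1# * pow x (k ∸ m)                          ≈⟨ *-identityˡ _ ⟩
    pow x (k ∸ m)                               ∎

  bracket-suc : ∀ x j → bracket x (suc j) ≈ bracket x j * (1# - fromℕ j * x)
  bracket-suc x zero    = sym (begin
    1# * (1# - 0# * x) ≈⟨ *-identityˡ _ ⟩
    1# - 0# * x        ≈⟨ +-congˡ (-‿cong (zeroˡ x)) ⟩
    1# - 0#            ≈⟨ +-congˡ -0#≈0# ⟩
    1# + 0#            ≈⟨ +-identityʳ 1# ⟩
    1#                 ∎)
    where open import Algebra.Properties.Ring ring using (-0#≈0#)
  bracket-suc x (suc j) = refl

  -- λ (1/λ - i) = 1 - iλ, and the factor for i = 0 is 1, which is why [λ]_m starts at i = 1.
  pow*fallingFactorial≈bracket : ∀ x → ¬ (x ≈ 0#) → ∀ m →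
    pow x m * prodBelow m (λ i → x ⁻¹ - fromℕ i) ≈ bracket x m
  pow*fallingFactorial≈bracket x x≉0 zero    = *-identityˡ _
  pow*fallingFactorial≈bracket x x≉0 (suc m) = begin
    (pow x m * x) * (prodBelow m falling * (x ⁻¹ - fromℕ m))
      ≈⟨ solve 4 (λ a l b u → (a :* l) :* (b :* u) := (a :* b) :* (l :* u)) refl (pow x m) x (prodBelow m falling) _ ⟩
    (pow x m * prodBelow m falling) * (x * (x ⁻¹ - fromℕ m))
      ≈⟨ *-cong (pow*fallingFactorial≈bracket x x≉0 m)
                (trans (x[y-z]≈xy-xz x _ _) (+-cong (inverseʳ x x≉0) (-‿cong (*-comm _ _)))) ⟩
    bracket x m * (1# - fromℕ m * x) ≈⟨ bracket-suc x m ⟨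
    bracket x (suc m) ∎
    where
    open import Algebra.Properties.Ring ring using (x[y-z]≈xy-xz)
    falling : ℕ → Carrier
    falling i = x ⁻¹ - fromℕ i

module StirlingIdentities {c ℓ : Level} (R : CommutativeRing c ℓ) where
  open CommutativeRing R
  open RingOps ring
  open RingSums ring
  open import Relation.Binary.Reasoning.Setoid setoid
  open import Algebra.Solver.Ring.NaturalCoefficients.Default commutativeSemiring

  S : ℕ → ℕ → Carrier
  S n m = fromℕ (stirling2 n m)

  S-suc : ∀ n m → S (suc n) (suc m) ≈ fromℕ (suc m) * S n (suc m) + S n m
  S-suc n m = trans (fromℕ-+ (suc m ℕ.* stirling2 n (suc m)) _) (+-congʳ (fromℕ-* (suc m) (stirling2 n (suc m))))

  binomialStirlingSum : ℕ → ℕ → Carrier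
  binomialStirlingSum n m = sumTo n (λ i → fromℕ (n C i) * S i m)

  S-suc≈binomialStirlingSum : ∀ n m → S (suc n) (suc m) ≈ binomialStirlingSum n m
  S-suc≈binomialStirlingSum zero zero =
    solve 0 (con 1 :+ con 0 := con 0 :+ (con 1 :+ con 0) :* (con 1 :+ con 0)) refl
  S-suc≈binomialStirlingSum zero (suc m) =
    trans (fromℕ-cong (stirling2-vanish {1} {suc (suc m)} (s≤s (s≤s z≤n))))
          (solve 0 (con 0 := con 0 :+ (con 1 :+ con 0) :* con 0) refl)
  S-suc≈binomialStirlingSum (suc n) m = begin
    S (suc (suc n)) (suc m)                                    ≈⟨ S-suc (suc n) m ⟩
    fromℕ (suc m) * S (suc n) (suc m) + S (suc n) m            ≈⟨ +-congʳ (*-congˡ (S-suc≈binomialStirlingSum n m)) ⟩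
    fromℕ (suc m) * σ m + S (suc n) m                          ≈⟨ shiftedSum m ⟨
    sumTo n (λ i → fromℕ (n C i) * S (suc i) m) + σ m          ≈⟨ sumTo-pascal n (λ i → S i m) ⟩
    binomialStirlingSum (suc n) m                              ∎
    where
    σ : ℕ → Carrier
    σ = binomialStirlingSum n
    shiftedSum : ∀ m → sumTo n (λ i → fromℕ (n C i) * S (suc i) m) + σ m ≈ fromℕ (suc m) * σ m + S (suc n) m
    shiftedSum zero = begin
      sumTo n (λ i → fromℕ (n C i) * 0#) + σ 0 ≈⟨ +-congʳ (sumBelow-zero (suc n) _ (λ i _ → zeroʳ _)) ⟩
      0# + σ 0                                 ≈⟨ solve 1 (λ s → con 0 :+ s := (con 1 :+ con 0) :* s :+ con 0) refl (σ 0) ⟩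
      fromℕ 1 * σ 0 + 0#                       ∎
    shiftedSum (suc m) = begin
      sumTo n (λ i → fromℕ (n C i) * S (suc i) (suc m)) + σ (suc m)
        ≈⟨ +-congʳ (sumBelow-cong (suc n) (λ i → *-congˡ (S-suc i m))) ⟩
      sumTo n (λ i → fromℕ (n C i) * (fromℕ (suc m) * S i (suc m) + S i m)) + σ (suc m)
        ≈⟨ +-congʳ (sumBelow-cong (suc n) (λ i → solve 4 (λ c x s t → c :* (x :* s :+ t) := x :* (c :* s) :+ c :* t)
                                                       refl (fromℕ (n C i)) (fromℕ (suc m)) (S i (suc m)) (S i m))) ⟩
      sumTo n (λ i → fromℕ (suc m) * (fromℕ (n C i) * S i (suc m)) + fromℕ (n C i) * S i m) + σ (suc m)
        ≈⟨ +-congʳ (trans (sumBelow-+ (suc n) _ _) (+-congʳ (sym (*-distribˡ-sumBelow (suc n) _ _)))) ⟩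
      (fromℕ (suc m) * σ (suc m) + σ m) + σ (suc m)
        ≈⟨ solve 3 (λ x s t → (x :* s :+ t) :+ s := (con 1 :+ x) :* s :+ t) refl (fromℕ (suc m)) (σ (suc m)) (σ m) ⟩
      fromℕ (suc (suc m)) * σ (suc m) + σ m
        ≈⟨ +-congˡ (S-suc≈binomialStirlingSum n m) ⟨
      fromℕ (suc (suc m)) * σ (suc m) + S (suc n) (suc m) ∎

  binomialStirlingSum-below : ∀ n m → sumBelow n (λ i → fromℕ (n C i) * S i m) ≈ fromℕ (suc m) * S n (suc m)
  binomialStirlingSum-below n m = +-cancelʳ (S n m) _ _ (begin
    sumBelow n (λ i → fromℕ (n C i) * S i m) + S n m ≈⟨ +-congˡ lastTerm ⟨
    binomialStirlingSum n m                          ≈⟨ S-suc≈binomialStirlingSum n m ⟨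
    S (suc n) (suc m)                                ≈⟨ S-suc n m ⟩
    fromℕ (suc m) * S n (suc m) + S n m              ∎)
    where
    open import Algebra.Properties.Ring ring using (+-cancelʳ)
    lastTerm : fromℕ (n C n) * S n m ≈ S n m
    lastTerm = trans (*-congʳ (trans (fromℕ-cong (nCn≡1 n)) (+-identityʳ 1#))) (*-identityˡ _)

selfAlgebra : ∀ {c ℓ} (K : CharZeroField c ℓ) → Algebra K c ℓ
selfAlgebra K = record
  { ring      = ring
  ; ι         = id
  ; ι-hom     = Identity.isRingHomomorphism rawRing refl
  ; ι-central = *-comm
  }
  where open CharZeroField K

module AlgebraProperties {c ℓ a ℓa : Level} {K : CharZeroField c ℓ} (𝒜 : Algebra K a ℓa) where
  private module K = CharZeroField K
  open Algebra 𝒜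
  open IsRingHomomorphism ι-hom
  open RingSums ring
  open import Relation.Binary.Reasoning.Setoid setoid

  ι-cong-* : ∀ {x y} X → x K.≈ y → ι x * X ≈ ι y * X
  ι-cong-* X x≈y = *-congʳ (⟦⟧-cong x≈y)

  ι-zero-* : ∀ {x} X → x K.≈ K.0# → ι x * X ≈ 0#
  ι-zero-* X x≈0 = trans (ι-cong-* X x≈0) (trans (*-congʳ 0#-homo) (zeroˡ X))

  ι-one-* : ∀ {x} X → x K.≈ K.1# → ι x * X ≈ X
  ι-one-* X x≈1 = trans (ι-cong-* X x≈1) (trans (*-congʳ 1#-homo) (*-identityˡ X))

  ι-+-* : ∀ x y X → ι x * X + ι y * X ≈ ι (x K.+ y) * X
  ι-+-* x y X = trans (sym (distribʳ X (ι x) (ι y))) (*-congʳ (sym (+-homo x y)))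

  ι-*-assoc : ∀ x y X → ι x * (ι y * X) ≈ ι (x K.* y) * X
  ι-*-assoc x y X = trans (sym (*-assoc _ _ _)) (*-congʳ (sym (*-homo x y)))

  ι-*-assoc-* : ∀ x y X Y → ι x * ((ι y * X) * Y) ≈ (ι (x K.* y) * X) * Y
  ι-*-assoc-* x y X Y = trans (sym (*-assoc _ _ _)) (*-congʳ (ι-*-assoc x y X))

  ι-*-*ι : ∀ x y X → (ι x * X) * ι y ≈ ι (x K.* y) * X
  ι-*-*ι x y X = trans (*-assoc _ _ _) (trans (*-congˡ (sym (ι-central y X))) (ι-*-assoc x y X))

  *-ι-comm : ∀ x X Y → X * (ι x * Y) ≈ ι x * (X * Y)
  *-ι-comm x X Y = trans (sym (*-assoc _ _ _)) (trans (*-congʳ (sym (ι-central x X))) (*-assoc _ _ _))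

  ι-*-interchange : ∀ x y X Y → (ι x * X) * (ι y * Y) ≈ ι (x K.* y) * (X * Y)
  ι-*-interchange x y X Y = trans (*-assoc _ _ _) (trans (*-congˡ (*-ι-comm y X Y)) (ι-*-assoc x y (X * Y)))

  ι-fromℕ : ∀ m → ι (K.fromℕ m) ≈ fromℕ m
  ι-fromℕ zero    = 0#-homo
  ι-fromℕ (suc m) = trans (+-homo _ _) (+-cong 1#-homo (ι-fromℕ m))

  ι-sumBelow : ∀ n f → ι (K.sumBelow n f) ≈ sumBelow n (λ i → ι (f i))
  ι-sumBelow zero    f = 0#-homo
  ι-sumBelow (suc n) f = trans (+-homo _ _) (+-congʳ (ι-sumBelow n f))

  pow-ι-* : ∀ x X m → pow (ι x * X) m ≈ ι (K.pow x m) * pow X m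
  pow-ι-* x X zero    = sym (trans (*-congʳ 1#-homo) (*-identityˡ 1#))
  pow-ι-* x X (suc m) = trans (*-congʳ (pow-ι-* x X m)) (ι-*-interchange _ _ _ _)

  ι⁻¹-*-cancel : ∀ x U V → ¬ (x K.≈ K.0#) → ι (x K.⁻¹) * U ≈ ι (x K.⁻¹) * V → U ≈ V
  ι⁻¹-*-cancel x U V x≉0 eq = begin
    U                        ≈⟨ unit U ⟩
    ι x * (ι (x K.⁻¹) * U)   ≈⟨ *-congˡ eq ⟩
    ι x * (ι (x K.⁻¹) * V)   ≈⟨ unit V ⟨
    V                        ∎
    where
    unit : ∀ W → W ≈ ι x * (ι (x K.⁻¹) * W)
    unit W = sym (trans (ι-*-assoc _ _ _) (trans (ι-cong-* W (K.inverseʳ x x≉0)) (trans (*-congʳ 1#-homo) (*-identityˡ W))))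

module SeriesProperties {c ℓ a ℓa : Level} {K : CharZeroField c ℓ} (𝒜 : Algebra K a ℓa) where
  private module K = CharZeroField K
  private module KS = Series (selfAlgebra K)
  open Algebra 𝒜
  open Series 𝒜
  open IsRingHomomorphism ι-hom
  open RingSums ring
  open AlgebraProperties 𝒜
  open import Relation.Binary.Reasoning.Setoid setoid

  constS-1# : ∀ n → constS 1# n ≈ ι (KS.constS K.1# n)
  constS-1# zero    = sym 1#-homo
  constS-1# (suc n) = sym 0#-homo

  ⊛-constˡ : ∀ x W n → (constS x ⊛ W) n ≈ x * W n
  ⊛-constˡ x W n = sumTo-only-first n _ (λ i _ → zeroˡ _)

  ⊛-constʳ : ∀ W x n → (W ⊛ constS x) n ≈ W n * x
  ⊛-constʳ W x n = trans (sumTo-only-last n _ below) (*-congˡ (reflexive (≡.cong (constS x) (ℕ.n∸n≡0 n))))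
    where
    below : ∀ i → i < n → W i * constS x (n ∸ i) ≈ 0#
    below i (s≤s i≤n-1) = trans (*-congˡ (reflexive (≡.cong (constS x) (ℕ.+-∸-assoc 1 i≤n-1)))) (zeroʳ _)

  powS-cong : ∀ {W W'} → W ≋ W' → ∀ m → powS W m ≋ powS W' m
  powS-cong W≋W' zero    n = refl
  powS-cong W≋W' (suc m) n = sumBelow-cong (suc n) (λ i → *-cong (powS-cong W≋W' m i) (W≋W' (n ∸ i)))

  powS-ι-* : ∀ z X m n → powS (λ n → ι (z n) * X) m n ≈ ι (KS.powS z m n) * pow X m
  powS-ι-* z X zero    n = trans (constS-1# n) (sym (*-identityʳ _))
  powS-ι-* z X (suc m) n = begin
    sumTo n (λ i → powS zX m i * zX (n ∸ i))
      ≈⟨ sumBelow-cong (suc n) (λ i → trans (*-congʳ (powS-ι-* z X m i)) (ι-*-interchange _ _ _ _)) ⟩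
    sumTo n (λ i → ι (KS.powS z m i K.* z (n ∸ i)) * pow X (suc m))
      ≈⟨ *-distribʳ-sumBelow (suc n) _ _ ⟨
    sumTo n (λ i → ι (KS.powS z m i K.* z (n ∸ i))) * pow X (suc m)
      ≈⟨ *-congʳ (ι-sumBelow (suc n) _) ⟨
    ι (KS.powS z (suc m) n) * pow X (suc m) ∎
    where
    zX : PS
    zX n = ι (z n) * X

module ExponentialSeries {c ℓ : Level} (K : CharZeroField c ℓ) where
  open CharZeroField K
  open FieldOps K
  open Series (selfAlgebra K)
  open RingSums ring
  open CharZeroFieldProperties K
  open StirlingIdentities commutativeRing
  open import Relation.Binary.Reasoning.Setoid setoid
  open import Algebra.Solver.Ring.NaturalCoefficients.Default commutativeSemiring
  open import Algebra.Properties.Ring ring using (-0#≈0#)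

  expMinusOne : Carrier → PS
  expMinusOne ε = liftS (expK ε) ⊖ constS 1#

  expMinusOne-zero : ∀ ε → expMinusOne ε 0 ≈ 0#
  expMinusOne-zero ε = trans (+-congʳ (trans (*-identityˡ _) fromℕ1⁻¹≈1)) (-‿inverseʳ 1#)

  expMinusOne-suc : ∀ ε n → expMinusOne ε (suc n) ≈ expK ε (suc n)
  expMinusOne-suc ε n = trans (+-congˡ -0#≈0#) (+-identityʳ _)

  powS-expMinusOne : ∀ ε m n → powS (expMinusOne ε) m n ≈ fromℕ (m !) * S n m * expK ε n
  powS-expMinusOne ε zero zero = sym (trans (*-congˡ (*-congˡ fromℕ1⁻¹≈1))
    (solve 0 (((con 1 :+ con 0) :* (con 1 :+ con 0)) :* (con 1 :* con 1) := con 1) refl))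
  powS-expMinusOne ε zero (suc n) = sym (trans (*-congʳ (zeroʳ _)) (zeroˡ _))
  powS-expMinusOne ε (suc m) n = begin
    sumTo n (λ i → powS Y m i * Y (n ∸ i))
      ≈⟨ sumBelow-cong (suc n) (λ i → *-congʳ (powS-expMinusOne ε m i)) ⟩
    sumTo n (λ i → g i * Y (n ∸ i))
      ≈⟨ sumTo-drop-last n _ (trans (*-congˡ (trans (reflexive (≡.cong Y (ℕ.n∸n≡0 n))) (expMinusOne-zero ε))) (zeroʳ _)) ⟩
    sumBelow n (λ i → g i * Y (n ∸ i))
      ≈⟨ sumBelow-cong-< n term ⟩
    sumBelow n (λ i → Q * (fromℕ (n C i) * S i m))
      ≈⟨ *-distribˡ-sumBelow n _ _ ⟨
    Q * sumBelow n (λ i → fromℕ (n C i) * S i m)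
      ≈⟨ *-congˡ (binomialStirlingSum-below n m) ⟩
    Q * (fromℕ (suc m) * S n (suc m))
      ≈⟨ solve 5 (λ a e N b s → (a :* e :* N) :* (b :* s) := (b :* a) :* s :* (e :* N)) refl
               (fromℕ (m !)) (pow ε n) (fromℕ (n !) ⁻¹) (fromℕ (suc m)) (S n (suc m)) ⟩
    (fromℕ (suc m) * fromℕ (m !)) * S n (suc m) * expK ε n
      ≈⟨ *-congʳ (*-congʳ (fromℕ-* (suc m) (m !))) ⟨
    fromℕ (suc m !) * S n (suc m) * expK ε n ∎
    where
    Y : PS
    Y = expMinusOne ε
    g : ℕ → Carrier
    g i = fromℕ (m !) * S i m * expK ε i
    Q : Carrier
    Q = fromℕ (m !) * pow ε n * fromℕ (n !) ⁻¹
    term : ∀ i → i < n → g i * Y (n ∸ i) ≈ Q * (fromℕ (n C i) * S i m)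
    term i (s≤s {n = n-1} i≤n-1) = begin
      g i * Y (n ∸ i)
        ≈⟨ *-congˡ (trans (reflexive (≡.cong Y (ℕ.+-∸-assoc 1 i≤n-1)))
                   (trans (expMinusOne-suc ε (n-1 ∸ i)) (reflexive (≡.cong (expK ε) (≡.sym (ℕ.+-∸-assoc 1 i≤n-1)))))) ⟩
      (fromℕ (m !) * S i m * (pow ε i * fromℕ (i !) ⁻¹)) * (pow ε (n ∸ i) * fromℕ ((n ∸ i) !) ⁻¹)
        ≈⟨ solve 6 (λ a s e ii e' jj → (a :* s :* (e :* ii)) :* (e' :* jj) := (a :* s) :* (e :* e') :* (ii :* jj)) refl
                 (fromℕ (m !)) (S i m) (pow ε i) (fromℕ (i !) ⁻¹) (pow ε (n ∸ i)) (fromℕ ((n ∸ i) !) ⁻¹) ⟩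
      (fromℕ (m !) * S i m) * (pow ε i * pow ε (n ∸ i)) * (fromℕ (i !) ⁻¹ * fromℕ ((n ∸ i) !) ⁻¹)
        ≈⟨ *-cong (*-congˡ (trans (sym (pow-+ ε i (n ∸ i))) (reflexive (≡.cong (pow ε) (ℕ.m+[n∸m]≡n i≤n)))))
                  (factorial⁻¹-* n i i≤n) ⟩
      (fromℕ (m !) * S i m) * pow ε n * (fromℕ (n !) ⁻¹ * fromℕ (n C i))
        ≈⟨ solve 5 (λ a s e N c → (a :* s) :* e :* (N :* c) := (a :* e :* N) :* (c :* s)) refl
                 (fromℕ (m !)) (S i m) (pow ε n) (fromℕ (n !) ⁻¹) (fromℕ (n C i)) ⟩
      Q * (fromℕ (n C i) * S i m) ∎
      where
      i≤n : i ≤ n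
      i≤n = ℕ.m≤n⇒m≤1+n i≤n-1

module StirlingCoefficients {c ℓ : Level} (K : CharZeroField c ℓ) (lam ε : CharZeroField.Carrier K) where
  open CharZeroField K
  open FieldOps K
  open RingSums ring
  open CharZeroFieldProperties K
  open StirlingIdentities commutativeRing
  open import Relation.Binary.Reasoning.Setoid setoid
  open import Algebra.Solver.Ring.NaturalCoefficients.Default commutativeSemiring

  coeff : ℕ → ℕ → Carrier
  coeff k j = S k j * pow ε (k ∸ j) * bracket lam j

  coeff-vanish : ∀ {k j} → k < j → coeff k j ≈ 0#
  coeff-vanish k<j = trans (*-congʳ (trans (*-congʳ (fromℕ-cong (stirling2-vanish k<j))) (zeroˡ _))) (zeroˡ _)

  coeff-diagonal : ∀ k → coeff k k ≈ bracket lam k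
  coeff-diagonal k = begin
    S k k * pow ε (k ∸ k) * bracket lam k
      ≈⟨ *-congʳ (*-cong (fromℕ-cong (stirling2-diagonal k)) (reflexive (≡.cong (pow ε) (ℕ.n∸n≡0 k)))) ⟩
    (1# + 0#) * 1# * bracket lam k       ≈⟨ *-congʳ (trans (*-identityʳ _) (+-identityʳ 1#)) ⟩
    1# * bracket lam k                   ≈⟨ *-identityˡ _ ⟩
    bracket lam k                        ∎

  coeff-suc-zero : ∀ k → coeff (suc k) 0 ≈ 0#
  coeff-suc-zero k = trans (*-congʳ (zeroˡ _)) (zeroˡ _)

  -- ε^{k-j-1} ε = ε^{k-j} unless j = k, where S(k,k+1) = 0 kills both sides.
  S*pow-absorb : ∀ k j → j ≤ k → S k (suc j) * pow ε (k ∸ suc j) * ε ≈ S k (suc j) * pow ε (k ∸ j)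
  S*pow-absorb k j j≤k with ℕ.m≤n⇒m<n∨m≡n j≤k
  S*pow-absorb (suc k) j _ | inj₁ (s≤s j≤k) =
    trans (*-assoc _ _ _) (*-congˡ (reflexive (≡.cong (pow ε) (≡.sym (ℕ.+-∸-assoc 1 j≤k)))))
  S*pow-absorb k j _ | inj₂ ≡.refl =
    trans (*-congʳ (*-congʳ S≈0)) (trans (*-congʳ (zeroˡ _)) (trans (zeroˡ _) (sym (trans (*-congʳ S≈0) (zeroˡ _)))))
    where
    S≈0 : S j (suc j) ≈ 0#
    S≈0 = fromℕ-cong (stirling2-vanish {j} {suc j} ℕ.≤-refl)

  coeff-suc : ∀ k j → j ≤ k →
    coeff k (suc j) * (fromℕ (suc j) * ε) + coeff k j * (1# - fromℕ j * lam) ≈ coeff (suc k) (suc j)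
  coeff-suc k j j≤k = begin
    (s₁ * e′ * bracket lam (suc j)) * ((1# + J) * ε) + (s₀ * e * β) * w
      ≈⟨ +-congʳ (*-congʳ (*-congˡ (bracket-suc lam j))) ⟩
    (s₁ * e′ * (β * w)) * ((1# + J) * ε) + (s₀ * e * β) * w
      ≈⟨ solve 8 (λ s₁ e′ β w J ε s₀ e → (s₁ :* e′ :* (β :* w)) :* ((con 1 :+ J) :* ε) :+ (s₀ :* e :* β) :* w
                                      := ((con 1 :+ J) :* (s₁ :* e′ :* ε) :+ s₀ :* e) :* (β :* w))
               refl s₁ e′ β w J ε s₀ e ⟩
    ((1# + J) * (s₁ * e′ * ε) + s₀ * e) * (β * w)
      ≈⟨ *-congʳ (+-congʳ (*-congˡ (S*pow-absorb k j j≤k))) ⟩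
    ((1# + J) * (s₁ * e) + s₀ * e) * (β * w)
      ≈⟨ solve 6 (λ J s₁ e s₀ β w → ((con 1 :+ J) :* (s₁ :* e) :+ s₀ :* e) :* (β :* w)
                                 := ((con 1 :+ J) :* s₁ :+ s₀) :* e :* (β :* w))
               refl J s₁ e s₀ β w ⟩
    ((1# + J) * s₁ + s₀) * e * (β * w)
      ≈⟨ *-cong (*-congʳ (S-suc k j)) (bracket-suc lam j) ⟨
    coeff (suc k) (suc j) ∎
    where
    s₀ s₁ e e′ β J w : Carrier
    s₀ = S k j
    s₁ = S k (suc j)
    e  = pow ε (k ∸ j)
    e′ = pow ε (k ∸ suc j)
    β  = bracket lam j
    J  = fromℕ j
    w  = 1# - J * lam

  seriesCoefficient : ¬ (lam ≈ 0#) → ¬ (ε ≈ 0#) → ∀ k m → m ≤ k →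
    fromℕ (m !) * S k m * expK ε k * pow (lam * ε ⁻¹) m * gbinom (lam ⁻¹) m ≈ fromℕ (k !) ⁻¹ * coeff k m
  seriesCoefficient lam≉0 ε≉0 k m m≤k = begin
    fm * s * (pk * ik) * pow (lam * ε ⁻¹) m * (pr * im)  ≈⟨ *-congʳ (*-congˡ (pow-* lam (ε ⁻¹) m)) ⟩
    fm * s * (pk * ik) * (pl * pe) * (pr * im)
      ≈⟨ solve 8 (λ fm s pk ik pl pe pr im → fm :* s :* (pk :* ik) :* (pl :* pe) :* (pr :* im)
                                          := (pl :* pr) :* (pe :* pk) :* (fm :* im) :* (s :* ik))
               refl fm s pk ik pl pe pr im ⟩
    (pl * pr) * (pe * pk) * (fm * im) * (s * ik)
      ≈⟨ *-congʳ (*-cong (*-cong (pow*fallingFactorial≈bracket lam lam≉0 m) (pow-⁻¹-* ε ε≉0 m k m≤k))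
                         (inverseʳ _ (fromℕ-!-nonzero m))) ⟩
    bracket lam m * pow ε (k ∸ m) * 1# * (s * ik)
      ≈⟨ solve 4 (λ b e s ik → b :* e :* con 1 :* (s :* ik) := ik :* (s :* e :* b)) refl (bracket lam m) (pow ε (k ∸ m)) s ik ⟩
    ik * coeff k m ∎
    where
    fm s pk ik pl pe pr im : Carrier
    fm = fromℕ (m !)
    s  = S k m
    pk = pow ε k
    ik = fromℕ (k !) ⁻¹
    pl = pow lam m
    pe = pow (ε ⁻¹) m
    pr = prodBelow m (λ i → lam ⁻¹ - fromℕ i)
    im = fromℕ (m !) ⁻¹

module Expansion {c ℓ a ℓa : Level} {K : CharZeroField c ℓ} (𝒜 : Algebra K a ℓa)
                 (A B : Algebra.Carrier 𝒜) (lam ε : CharZeroField.Carrier K) where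
  private module K = CharZeroField K
  open FieldOps K
  open Algebra 𝒜
  open IsRingHomomorphism ι-hom
  open RingSums ring
  open AlgebraProperties 𝒜
  open StirlingCoefficients K lam ε
  open import Relation.Binary.Reasoning.Setoid setoid
  open import Algebra.Properties.CommutativeSemigroup +-commutativeSemigroup using (interchange; x∙yz≈y∙xz)

  Poly : ℕ → Carrier
  Poly k = sumTo k (λ j → ι (coeff k j) * pow A j)

  binomialSum : ℕ → Carrier
  binomialSum n = sumTo n (λ k → ι (K.fromℕ (n C k)) * (Poly k * pow B (n ∸ k)))

  Poly-zero : Poly 0 ≈ 1#
  Poly-zero = trans (+-identityˡ _) (ι-one-* 1# (coeff-diagonal 0))

  Poly-suc : ∀ k → Poly (suc k) ≈ sumTo k (λ j → ι (coeff (suc k) (suc j)) * pow A (suc j))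
  Poly-suc k = trans (sumBelow-suc-first (suc k) _) (trans (+-congʳ (ι-zero-* _ (coeff-suc-zero k))) (+-identityˡ _))

  stirlingSum : ℕ → Carrier
  stirlingSum n = sumTo n (λ k →
    ι (K.pow ε (n ∸ k)) *
    sumTo k (λ j → ι (K.fromℕ (n C j) K.* K.fromℕ (stirling2 (n ∸ j) (k ∸ j)) K.* bracket lam (k ∸ j))
                   * pow A (k ∸ j) * pow B j))

  binomialSum≈stirlingSum : ∀ n → binomialSum n ≈ stirlingSum n
  binomialSum≈stirlingSum n = begin
    binomialSum n
      ≈⟨ sumTo-cong-≤ n (λ k k≤n → trans (*-congˡ (*-distribʳ-sumBelow (suc k) _ _))
                         (trans (*-distribˡ-sumBelow (suc k) _ _)
                                (sumBelow-cong (suc k) (λ j → trans (ι-*-assoc-* _ _ _ _) (left k j k≤n))))) ⟩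
    sumTo n (λ k → sumTo k (λ j → T j (n ∸ k)))
      ≈⟨ sumTo-triangle n T ⟩
    sumTo n (λ k → sumTo k (λ j → T (k ∸ j) j))
      ≈⟨ sumTo-cong-≤ n (λ k k≤n → trans (*-distribˡ-sumBelow (suc k) _ _)
                         (sumTo-cong-≤ k (λ j j≤k → trans (ι-*-assoc-* _ _ _ _) (right k j k≤n j≤k)))) ⟨
    stirlingSum n ∎
    where
    open import Algebra.Solver.Ring.NaturalCoefficients.Default K.commutativeSemiring
    T : ℕ → ℕ → Carrier
    T a b = ι (K.fromℕ (n C b) K.* coeff (n ∸ b) a) * pow A a * pow B b
    left : ∀ k j → k ≤ n → ι (K.fromℕ (n C k) K.* coeff k j) * pow A j * pow B (n ∸ k) ≈ T j (n ∸ k)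
    left k j k≤n = *-congʳ (ι-cong-* _ (K.reflexive (≡.cong₂ (λ u v → K.fromℕ u K.* coeff v j)
                                                     (nCk≡nC[n∸k] k≤n) (≡.sym (ℕ.m∸[m∸n]≡n k≤n)))))
    right : ∀ k j → k ≤ n → j ≤ k →
      ι (K.pow ε (n ∸ k) K.* (K.fromℕ (n C j) K.* K.fromℕ (stirling2 (n ∸ j) (k ∸ j)) K.* bracket lam (k ∸ j)))
        * pow A (k ∸ j) * pow B j ≈ T (k ∸ j) j
    right k j k≤n j≤k = *-congʳ (ι-cong-* _ (K.trans
      (solve 4 (λ e c s b → e :* (c :* s :* b) := c :* (s :* e :* b)) K.refl
             (K.pow ε (n ∸ k)) (K.fromℕ (n C j)) (K.fromℕ (stirling2 (n ∸ j) (k ∸ j))) (bracket lam (k ∸ j)))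
      (K.reflexive (≡.cong (λ m → K.fromℕ (n C j) K.* (K.fromℕ (stirling2 (n ∸ j) (k ∸ j))
                                                         K.* K.pow ε m K.* bracket lam (k ∸ j)))
                           (≡.sym ([m∸o]∸[n∸o]≡m∸n j≤k k≤n))))))

  Poly-one : Poly 1 ≈ A
  Poly-one = begin
    (0# + ι (coeff 1 0) * 1#) + ι (coeff 1 1) * (1# * A)
      ≈⟨ +-cong (trans (+-identityˡ _) (ι-zero-* _ (coeff-suc-zero 0))) (trans (ι-one-* _ (coeff-diagonal 1)) (*-identityˡ A)) ⟩
    0# + A ≈⟨ +-identityˡ A ⟩
    A ∎

  Poly-two : Poly 2 ≈ ι ε * A + (A * A - ι lam * (A * A))
  Poly-two = begin
    ((0# + ι (coeff 2 0) * 1#) + ι (coeff 2 1) * (1# * A)) + ι (coeff 2 2) * ((1# * A) * A)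
      ≈⟨ +-cong (+-cong (trans (+-identityˡ _) (ι-zero-* _ (coeff-suc-zero 1)))
                        (*-cong (⟦⟧-cong coeff-2-1) (*-identityˡ A)))
                (*-cong (⟦⟧-cong (K.trans (coeff-diagonal 2) bracket-2)) (*-congʳ (*-identityˡ A))) ⟩
      (0# + ι ε * A) + ι (K.1# K.- lam) * (A * A)
      ≈⟨ +-cong (+-identityˡ _) (trans (*-congʳ (trans (+-homo _ _) (+-cong 1#-homo (-‿homo lam))))
                                        (trans ([y-z]x≈yx-zx _ _ _) (+-congʳ (*-identityˡ _)))) ⟩
    ι ε * A + (A * A - ι lam * (A * A)) ∎
    where
    open import Algebra.Properties.Ring ring using ([y-z]x≈yx-zx)
    coeff-2-1 : coeff 2 1 K.≈ ε
    coeff-2-1 = K.trans (K.*-identityʳ _) (K.trans (K.*-congʳ (K.+-identityʳ K.1#)) (K.trans (K.*-identityˡ _) (K.*-identityˡ ε)))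
    bracket-2 : bracket lam 2 K.≈ K.1# K.- lam
    bracket-2 = K.trans (K.*-identityˡ _) (K.+-congˡ (K.-‿cong (K.trans (K.*-congʳ (K.+-identityʳ K.1#)) (K.*-identityˡ lam))))

  square-expansion : pow (A + B) 2 ≈ A * A + (B * A + (A * B + B * B))
  square-expansion = begin
    (1# * (A + B)) * (A + B)            ≈⟨ *-congʳ (*-identityˡ _) ⟩
    (A + B) * (A + B)                   ≈⟨ trans (distribʳ _ _ _) (+-cong (distribˡ _ _ _) (distribˡ _ _ _)) ⟩
    (A * A + A * B) + (B * A + B * B)   ≈⟨ solve 4 (λ aa ab ba bb → (aa ⊕ ab) ⊕ (ba ⊕ bb) ⊜ aa ⊕ (ba ⊕ (ab ⊕ bb)))
                                                 refl (A * A) (A * B) (B * A) (B * B) ⟩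
    A * A + (B * A + (A * B + B * B))   ∎
    where open import Algebra.Solver.CommutativeMonoid +-commutativeMonoid using (solve; _⊕_; _⊜_)

  binomialSum-two : binomialSum 2 ≈ A * A + ((ι ε * A - ι lam * (A * A)) + A * B + (A * B + B * B))
  binomialSum-two = begin
    (0# + ι (K.fromℕ 1) * (Poly 0 * ((1# * B) * B))) + ι (K.fromℕ 2) * (Poly 1 * (1# * B)) + ι (K.fromℕ 1) * (Poly 2 * 1#)
      ≈⟨ +-cong (+-cong (+-congˡ term₀) term₁) term₂ ⟩
    (0# + B * B) + (A * B + A * B) + (ι ε * A + (A * A + - (ι lam * (A * A))))
      ≈⟨ solve 5 (λ bb ab ea aa la → ((0ₑ ⊕ bb) ⊕ (ab ⊕ ab)) ⊕ (ea ⊕ (aa ⊕ la))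
                                   ⊜ aa ⊕ (((ea ⊕ la) ⊕ ab) ⊕ (ab ⊕ bb)))
               refl (B * B) (A * B) (ι ε * A) (A * A) (- (ι lam * (A * A))) ⟩
    A * A + ((ι ε * A - ι lam * (A * A)) + A * B + (A * B + B * B)) ∎
    where
    open import Algebra.Solver.CommutativeMonoid +-commutativeMonoid using (solve; _⊕_; _⊜_) renaming (id to 0ₑ)
    term₀ : ι (K.fromℕ 1) * (Poly 0 * ((1# * B) * B)) ≈ B * B
    term₀ = trans (ι-one-* _ (K.+-identityʳ K.1#)) (trans (*-cong Poly-zero (*-congʳ (*-identityˡ B))) (*-identityˡ _))
    term₁ : ι (K.fromℕ 2) * (Poly 1 * (1# * B)) ≈ A * B + A * B
    term₁ = begin
      ι (K.fromℕ 2) * (Poly 1 * (1# * B))  ≈⟨ *-cong (ι-fromℕ 2) (*-cong Poly-one (*-identityˡ B)) ⟩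
      (1# + (1# + 0#)) * (A * B)           ≈⟨ *-congʳ (+-congˡ (+-identityʳ 1#)) ⟩
      (1# + 1#) * (A * B)                  ≈⟨ trans (distribʳ _ _ _) (+-cong (*-identityˡ _) (*-identityˡ _)) ⟩
      A * B + A * B                        ∎
    term₂ : ι (K.fromℕ 1) * (Poly 2 * 1#) ≈ ι ε * A + (A * A + - (ι lam * (A * A)))
    term₂ = trans (ι-one-* _ (K.+-identityʳ K.1#)) (trans (*-identityʳ _) Poly-two)

  commutator-from-square : pow (A + B) 2 ≈ binomialSum 2 → B * A - A * B ≈ ι ε * A - ι lam * (A * A)
  commutator-from-square square = begin
    B * A - A * B          ≈⟨ +-congʳ B*A≈F+A*B ⟩
    (F + A * B) - A * B    ≈⟨ +-assoc _ _ _ ⟩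
    F + (A * B - A * B)    ≈⟨ +-congˡ (-‿inverseʳ _) ⟩
    F + 0#                 ≈⟨ +-identityʳ _ ⟩
    F                      ∎
    where
    open import Algebra.Properties.Ring ring using (+-cancelˡ; +-cancelʳ)
    F : Carrier
    F = ι ε * A - ι lam * (A * A)
    B*A≈F+A*B : B * A ≈ F + A * B
    B*A≈F+A*B = +-cancelʳ (A * B + B * B) _ _
                  (+-cancelˡ (A * A) _ _ (trans (sym square-expansion) (trans square binomialSum-two)))

  module UnderRelation (commutator : B * A - A * B ≈ ι ε * A - ι lam * (A * A)) where

    B*A : B * A ≈ A * B + (ι ε * A + ι (K.- lam) * (A * A))
    B*A = begin
      B * A                                        ≈⟨ +-identityʳ _ ⟨
      B * A + 0#                                   ≈⟨ +-congˡ (-‿inverseˡ (A * B)) ⟨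
      B * A + (- (A * B) + A * B)                  ≈⟨ +-assoc _ _ _ ⟨
      (B * A - A * B) + A * B                      ≈⟨ +-congʳ commutator ⟩
      (ι ε * A - ι lam * (A * A)) + A * B          ≈⟨ +-comm _ _ ⟩
      A * B + (ι ε * A - ι lam * (A * A))          ≈⟨ +-congˡ (+-congˡ (trans (-‿distribˡ-* _ _) (*-congʳ (sym (-‿homo lam))))) ⟩
      A * B + (ι ε * A + ι (K.- lam) * (A * A))    ∎
      where open import Algebra.Properties.Ring ring using (-‿distribˡ-*)

    B*powA : ∀ j → B * pow A j ≈ pow A j * B + (ι (K.fromℕ j K.* ε) * pow A j + ι (K.- (K.fromℕ j K.* lam)) * pow A (suc j))
    B*powA zero = begin
      B * 1#                               ≈⟨ *-identityʳ B ⟩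
      B                                    ≈⟨ *-identityˡ B ⟨
      1# * B                               ≈⟨ +-identityʳ _ ⟨
      1# * B + 0#                          ≈⟨ +-congˡ (+-identityʳ 0#) ⟨
      1# * B + (0# + 0#)                   ≈⟨ +-congˡ (+-cong (ι-zero-* _ (K.zeroˡ ε)) (ι-zero-* _ (K.trans (K.-‿cong (K.zeroˡ lam)) K-0#≈0#))) ⟨
      1# * B + (ι (K.0# K.* ε) * 1# + ι (K.- (K.0# K.* lam)) * pow A 1) ∎
      where open import Algebra.Properties.Ring K.ring using () renaming (-0#≈0# to K-0#≈0#)
    B*powA (suc j) = begin
      B * (X₀ * A)                                                           ≈⟨ *-assoc _ _ _ ⟨
      (B * X₀) * A                                                           ≈⟨ *-congʳ (B*powA j) ⟩
      (X₀ * B + (ι cⱼ * X₀ + ι dⱼ * X₁)) * A                                   ≈⟨ distribʳ _ _ _ ⟩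
      (X₀ * B) * A + (ι cⱼ * X₀ + ι dⱼ * X₁) * A
        ≈⟨ +-cong (*-assoc _ _ _) (trans (distribʳ _ _ _) (+-cong (*-assoc _ _ _) (*-assoc _ _ _))) ⟩
      X₀ * (B * A) + (ι cⱼ * X₁ + ι dⱼ * X₂)                                   ≈⟨ +-congʳ (*-congˡ B*A) ⟩
      X₀ * (A * B + (ι ε * A + ι (K.- lam) * (A * A))) + (ι cⱼ * X₁ + ι dⱼ * X₂)
        ≈⟨ +-congʳ (trans (distribˡ _ _ _) (+-cong (sym (*-assoc _ _ _))
                     (trans (distribˡ _ _ _) (+-cong (*-ι-comm _ _ _) (trans (*-ι-comm _ _ _) (*-congˡ (sym (*-assoc _ _ _)))))))) ⟩
      (X₁ * B + (ι ε * X₁ + ι (K.- lam) * X₂)) + (ι cⱼ * X₁ + ι dⱼ * X₂)     ≈⟨ +-assoc _ _ _ ⟩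
      X₁ * B + ((ι ε * X₁ + ι (K.- lam) * X₂) + (ι cⱼ * X₁ + ι dⱼ * X₂))     ≈⟨ +-congˡ (interchange _ _ _ _) ⟩
      X₁ * B + ((ι ε * X₁ + ι cⱼ * X₁) + (ι (K.- lam) * X₂ + ι dⱼ * X₂))     ≈⟨ +-congˡ (+-cong (ι-+-* _ _ _) (ι-+-* _ _ _)) ⟩
      X₁ * B + (ι (ε K.+ cⱼ) * X₁ + ι (K.- lam K.+ dⱼ) * X₂)                 ≈⟨ +-congˡ (+-cong (ι-cong-* X₁ ε-step) (ι-cong-* X₂ lam-step)) ⟩
      X₁ * B + (ι (K.fromℕ (suc j) K.* ε) * X₁ + ι (K.- (K.fromℕ (suc j) K.* lam)) * X₂) ∎
      where
      open import Algebra.Properties.Ring K.ring using (-‿+-comm)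
      X₀ X₁ X₂ : Carrier
      X₀ = pow A j
      X₁ = pow A (suc j)
      X₂ = pow A (suc (suc j))
      cⱼ dⱼ : K.Carrier
      cⱼ = K.fromℕ j K.* ε
      dⱼ = K.- (K.fromℕ j K.* lam)
      ε-step : ε K.+ cⱼ K.≈ K.fromℕ (suc j) K.* ε
      ε-step = K.trans (K.+-congʳ (K.sym (K.*-identityˡ ε))) (K.sym (K.distribʳ ε K.1# (K.fromℕ j)))
      lam-step : K.- lam K.+ dⱼ K.≈ K.- (K.fromℕ (suc j) K.* lam)
      lam-step = K.trans (-‿+-comm lam _)
                   (K.-‿cong (K.trans (K.+-congʳ (K.sym (K.*-identityˡ lam))) (K.sym (K.distribʳ lam K.1# (K.fromℕ j)))))

    [A+B]*powA : ∀ j → (A + B) * pow A j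
                       ≈ pow A j * B + (ι (K.fromℕ j K.* ε) * pow A j + ι (K.1# K.- K.fromℕ j K.* lam) * pow A (suc j))
    [A+B]*powA j = begin
      (A + B) * X₀                                  ≈⟨ distribʳ _ _ _ ⟩
      A * X₀ + B * X₀                               ≈⟨ +-cong (pow-sucˡ A j) (B*powA j) ⟩
      X₁ + (X₀ * B + (ι cⱼ * X₀ + ι dⱼ * X₁))       ≈⟨ x∙yz≈y∙xz _ _ _ ⟩
      X₀ * B + (X₁ + (ι cⱼ * X₀ + ι dⱼ * X₁))       ≈⟨ +-congˡ (x∙yz≈y∙xz _ _ _) ⟩
      X₀ * B + (ι cⱼ * X₀ + (X₁ + ι dⱼ * X₁))       ≈⟨ +-congˡ (+-congˡ (trans (+-congʳ (sym (ι-one-* X₁ K.refl))) (ι-+-* _ _ _))) ⟩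
      X₀ * B + (ι cⱼ * X₀ + ι (K.1# K.+ dⱼ) * X₁)   ∎
      where
      X₀ X₁ : Carrier
      X₀ = pow A j
      X₁ = pow A (suc j)
      cⱼ dⱼ : K.Carrier
      cⱼ = K.fromℕ j K.* ε
      dⱼ = K.- (K.fromℕ j K.* lam)

    [A+B]*Poly : ∀ k → (A + B) * Poly k ≈ Poly k * B + Poly (suc k)
    [A+B]*Poly k = begin
      (A + B) * Poly k
        ≈⟨ *-distribˡ-sumBelow (suc k) _ _ ⟩
      sumTo k (λ j → (A + B) * (ι (coeff k j) * pow A j))
        ≈⟨ sumBelow-cong (suc k) (λ j → trans (*-ι-comm _ _ _) (*-congˡ ([A+B]*powA j))) ⟩
      sumTo k (λ j → ι (coeff k j) * (pow A j * B + (ι (cε j) * pow A j + ι (wλ j) * pow A (suc j))))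
        ≈⟨ sumBelow-cong (suc k) (λ j → trans (distribˡ _ _ _) (+-cong (sym (*-assoc _ _ _))
                                          (trans (distribˡ _ _ _) (+-cong (ι-*-assoc _ _ _) (ι-*-assoc _ _ _))))) ⟩
      sumTo k (λ j → ι (coeff k j) * pow A j * B + (ι (coeff k j K.* cε j) * pow A j + ι (coeff k j K.* wλ j) * pow A (suc j)))
        ≈⟨ trans (sumBelow-+ (suc k) _ _) (+-cong (sym (*-distribʳ-sumBelow (suc k) B _)) (sumBelow-+ (suc k) _ _)) ⟩
      Poly k * B + (Σε + Σλ)
        ≈⟨ +-congˡ (+-congʳ Σε≈shifted) ⟩
      Poly k * B + (sumTo k (λ j → ι (coeff k (suc j) K.* cε (suc j)) * pow A (suc j)) + Σλ)
        ≈⟨ +-congˡ (trans (sym (sumBelow-+ (suc k) _ _)) (sumTo-cong-≤ k (λ j j≤k → trans (ι-+-* _ _ _) (ι-cong-* _ (coeff-suc k j j≤k))))) ⟩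
      Poly k * B + sumTo k (λ j → ι (coeff (suc k) (suc j)) * pow A (suc j))
        ≈⟨ +-congˡ (Poly-suc k) ⟨
      Poly k * B + Poly (suc k) ∎
      where
      cε wλ : ℕ → K.Carrier
      cε j = K.fromℕ j K.* ε
      wλ j = K.1# K.- K.fromℕ j K.* lam
      Σε Σλ : Carrier
      Σε = sumTo k (λ j → ι (coeff k j K.* cε j) * pow A j)
      Σλ = sumTo k (λ j → ι (coeff k j K.* wλ j) * pow A (suc j))
      Σε≈shifted : Σε ≈ sumTo k (λ j → ι (coeff k (suc j) K.* cε (suc j)) * pow A (suc j))
      Σε≈shifted = begin
        Σε
          ≈⟨ sumBelow-suc-first k _ ⟩
        ι (coeff k 0 K.* cε 0) * 1# + sumBelow k (λ j → ι (coeff k (suc j) K.* cε (suc j)) * pow A (suc j))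
          ≈⟨ +-cong (ι-zero-* _ (K.trans (K.*-congˡ (K.zeroˡ ε)) (K.zeroʳ _)))
                    (sym (sumTo-drop-last k _ (ι-zero-* _ (K.trans (K.*-congʳ (coeff-vanish (ℕ.n<1+n k))) (K.zeroˡ _))))) ⟩
        0# + sumTo k (λ j → ι (coeff k (suc j) K.* cε (suc j)) * pow A (suc j))
          ≈⟨ +-identityˡ _ ⟩
        sumTo k (λ j → ι (coeff k (suc j) K.* cε (suc j)) * pow A (suc j)) ∎

    binomialExpansion : ∀ n → pow (A + B) n ≈ binomialSum n
    binomialExpansion zero = sym (begin
      0# + ι (K.fromℕ 1) * (Poly 0 * 1#) ≈⟨ +-identityˡ _ ⟩
      ι (K.fromℕ 1) * (Poly 0 * 1#)      ≈⟨ ι-one-* _ (K.+-identityʳ K.1#) ⟩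
      Poly 0 * 1#                        ≈⟨ trans (*-identityʳ _) Poly-zero ⟩
      1#                                 ∎)
    binomialExpansion (suc n) = begin
      pow (A + B) (suc n)           ≈⟨ pow-sucˡ _ n ⟨
      (A + B) * pow (A + B) n       ≈⟨ *-congˡ (binomialExpansion n) ⟩
      (A + B) * binomialSum n       ≈⟨ *-distribˡ-sumBelow (suc n) _ _ ⟩
      sumTo n (λ k → (A + B) * (ι (K.fromℕ (n C k)) * (Poly k * pow B (n ∸ k))))
        ≈⟨ sumTo-cong-≤ n (λ k k≤n → trans (*-ι-comm _ _ _) (trans (*-cong (ι-fromℕ (n C k)) (step k k≤n)) (distribˡ _ _ _))) ⟩
      sumTo n (λ k → fromℕ (n C k) * f (suc k) + fromℕ (n C k) * f k)
        ≈⟨ sumBelow-+ (suc n) _ _ ⟩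
      sumTo n (λ k → fromℕ (n C k) * f (suc k)) + sumTo n (λ k → fromℕ (n C k) * f k)
        ≈⟨ sumTo-pascal n f ⟩
      sumTo (suc n) (λ k → fromℕ (suc n C k) * f k)
        ≈⟨ sumBelow-cong (suc (suc n)) (λ k → *-congʳ (ι-fromℕ (suc n C k))) ⟨
      binomialSum (suc n) ∎
      where
      f : ℕ → Carrier
      f k = Poly k * pow B (suc n ∸ k)
      step : ∀ k → k ≤ n → (A + B) * (Poly k * pow B (n ∸ k)) ≈ f (suc k) + f k
      step k k≤n = begin
        (A + B) * (Poly k * pow B (n ∸ k))                    ≈⟨ *-assoc _ _ _ ⟨
        ((A + B) * Poly k) * pow B (n ∸ k)                    ≈⟨ *-congʳ ([A+B]*Poly k) ⟩
        (Poly k * B + Poly (suc k)) * pow B (n ∸ k)           ≈⟨ distribʳ _ _ _ ⟩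
        (Poly k * B) * pow B (n ∸ k) + f (suc k)              ≈⟨ +-comm _ _ ⟩
        f (suc k) + (Poly k * B) * pow B (n ∸ k)
          ≈⟨ +-congˡ (trans (*-assoc _ _ _) (*-congˡ (trans (pow-sucˡ B (n ∸ k)) (reflexive (≡.cong (pow B) (≡.sym (ℕ.+-∸-assoc 1 k≤n))))))) ⟩
        f (suc k) + f k ∎

module ExponentialFormula {c ℓ a ℓa : Level} {K : CharZeroField c ℓ} (𝒜 : Algebra K a ℓa)
                          (A B : Algebra.Carrier 𝒜) (lam ε : CharZeroField.Carrier K)
                          (lam≉0 : ¬ (CharZeroField._≈_ K lam (CharZeroField.0# K)))
                          (ε≉0 : ¬ (CharZeroField._≈_ K ε (CharZeroField.0# K))) where
  private module K = CharZeroField K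
  private module KS = Series (selfAlgebra K)
  open FieldOps K
  open Algebra 𝒜
  open Series 𝒜
  open IsRingHomomorphism ι-hom
  open RingSums ring
  open AlgebraProperties 𝒜
  open SeriesProperties 𝒜
  open ExponentialSeries K
  open CharZeroFieldProperties K using (factorial⁻¹-*; fromℕ-!-nonzero)
  open StirlingCoefficients K lam ε
  open Expansion 𝒜 A B lam ε
  open import Relation.Binary.Reasoning.Setoid setoid
  open import Algebra.Properties.Ring ring using (xyx⁻¹≈y)
  open import Algebra.Solver.Ring.NaturalCoefficients.Default K.commutativeSemiring

  Y X : PS
  Y = liftS (expK ε) ⊖ constS 1#
  X = constS 1# ⊕ ((constS (ι lam * A) ⊛ Y) ⊛ constS (ι (ε K.⁻¹)))

  Y≈ι : ∀ n → Y n ≈ ι (expMinusOne ε n)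
  Y≈ι n = trans (+-congˡ (trans (-‿cong (constS-1# n)) (sym (-‿homo _)))) (sym (+-homo _ _))

  X⊖1 : ∀ n → (X ⊖ constS 1#) n ≈ ι (expMinusOne ε n) * (ι (lam K.* ε K.⁻¹) * A)
  X⊖1 n = begin
    (constS 1# n + Z) - constS 1# n             ≈⟨ xyx⁻¹≈y _ _ ⟩
    Z                                           ≈⟨ ⊛-constʳ _ _ n ⟩
    (constS (ι lam * A) ⊛ Y) n * ι (ε K.⁻¹)     ≈⟨ *-congʳ (trans (⊛-constˡ _ Y n) (*-congˡ (Y≈ι n))) ⟩
    ((ι lam * A) * ι y) * ι (ε K.⁻¹)            ≈⟨ trans (*-congʳ (ι-*-*ι _ _ _)) (ι-*-*ι _ _ _) ⟩
    ι ((lam K.* y) K.* ε K.⁻¹) * A              ≈⟨ ι-cong-* A (solve 3 (λ l y e → (l :* y) :* e := y :* (l :* e)) K.refl lam y (ε K.⁻¹)) ⟩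
    ι (y K.* (lam K.* ε K.⁻¹)) * A              ≈⟨ ι-*-assoc _ _ _ ⟨
    ι y * (ι (lam K.* ε K.⁻¹) * A)              ∎
    where
    Z : Carrier
    Z = ((constS (ι lam * A) ⊛ Y) ⊛ constS (ι (ε K.⁻¹))) n
    y : K.Carrier
    y = expMinusOne ε n

  powμ-X : ∀ k → powμ X (lam K.⁻¹) k ≈ ι (K.fromℕ (k !) K.⁻¹) * Poly k
  powμ-X k = begin
    sumTo k (λ m → powS (X ⊖ constS 1#) m k * ι (gbinom (lam K.⁻¹) m))  ≈⟨ sumTo-cong-≤ k term ⟩
    sumTo k (λ m → ι (K.fromℕ (k !) K.⁻¹) * (ι (coeff k m) * pow A m))  ≈⟨ *-distribˡ-sumBelow (suc k) _ _ ⟨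
    ι (K.fromℕ (k !) K.⁻¹) * Poly k                                     ∎
    where
    term : ∀ m → m ≤ k → powS (X ⊖ constS 1#) m k * ι (gbinom (lam K.⁻¹) m) ≈ ι (K.fromℕ (k !) K.⁻¹) * (ι (coeff k m) * pow A m)
    term m m≤k = begin
      powS (X ⊖ constS 1#) m k * ι (gbinom (lam K.⁻¹) m)
        ≈⟨ *-congʳ (trans (powS-cong X⊖1 m k) (powS-ι-* (expMinusOne ε) _ m k)) ⟩
      ι (KS.powS (expMinusOne ε) m k) * pow (ι (lam K.* ε K.⁻¹) * A) m * ι (gbinom (lam K.⁻¹) m)
        ≈⟨ *-congʳ (trans (*-congˡ (pow-ι-* _ A m)) (ι-*-assoc _ _ _)) ⟩
      ι (KS.powS (expMinusOne ε) m k K.* K.pow (lam K.* ε K.⁻¹) m) * pow A m * ι (gbinom (lam K.⁻¹) m)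
        ≈⟨ ι-*-*ι _ _ _ ⟩
      ι (KS.powS (expMinusOne ε) m k K.* K.pow (lam K.* ε K.⁻¹) m K.* gbinom (lam K.⁻¹) m) * pow A m
        ≈⟨ ι-cong-* _ (K.trans (K.*-congʳ (K.*-congʳ (powS-expMinusOne ε m k))) (seriesCoefficient lam≉0 ε≉0 k m m≤k)) ⟩
      ι (K.fromℕ (k !) K.⁻¹ K.* coeff k m) * pow A m
        ≈⟨ ι-*-assoc _ _ _ ⟨
      ι (K.fromℕ (k !) K.⁻¹) * (ι (coeff k m) * pow A m) ∎

  powμ-X⊛expS : ∀ n → (powμ X (lam K.⁻¹) ⊛ expS B) n ≈ ι (K.fromℕ (n !) K.⁻¹) * binomialSum n
  powμ-X⊛expS n = begin
    sumTo n (λ i → powμ X (lam K.⁻¹) i * expS B (n ∸ i))                                   ≈⟨ sumTo-cong-≤ n term ⟩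
    sumTo n (λ i → ι (K.fromℕ (n !) K.⁻¹) * (ι (K.fromℕ (n C i)) * (Poly i * pow B (n ∸ i)))) ≈⟨ *-distribˡ-sumBelow (suc n) _ _ ⟨
    ι (K.fromℕ (n !) K.⁻¹) * binomialSum n                                                   ∎
    where
    term : ∀ i → i ≤ n → powμ X (lam K.⁻¹) i * expS B (n ∸ i)
                         ≈ ι (K.fromℕ (n !) K.⁻¹) * (ι (K.fromℕ (n C i)) * (Poly i * pow B (n ∸ i)))
    term i i≤n = begin
      powμ X (lam K.⁻¹) i * expS B (n ∸ i)
        ≈⟨ *-congʳ (powμ-X i) ⟩
      (ι (K.fromℕ (i !) K.⁻¹) * Poly i) * (ι (K.fromℕ ((n ∸ i) !) K.⁻¹) * pow B (n ∸ i))
        ≈⟨ ι-*-interchange _ _ _ _ ⟩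
      ι (K.fromℕ (i !) K.⁻¹ K.* K.fromℕ ((n ∸ i) !) K.⁻¹) * (Poly i * pow B (n ∸ i))
        ≈⟨ ι-cong-* _ (factorial⁻¹-* n i i≤n) ⟩
      ι (K.fromℕ (n !) K.⁻¹ K.* K.fromℕ (n C i)) * (Poly i * pow B (n ∸ i))
        ≈⟨ ι-*-assoc _ _ _ ⟨
      ι (K.fromℕ (n !) K.⁻¹) * (ι (K.fromℕ (n C i)) * (Poly i * pow B (n ∸ i))) ∎

  expS-formula : (∀ n → pow (A + B) n ≈ binomialSum n) → expS (A + B) ≋ (powμ X (lam K.⁻¹) ⊛ expS B)
  expS-formula expansion n = trans (*-congˡ (expansion n)) (sym (powμ-X⊛expS n))

  expansion-from-expS-formula : expS (A + B) ≋ (powμ X (lam K.⁻¹) ⊛ expS B) → ∀ n → pow (A + B) n ≈ binomialSum n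
  expansion-from-expS-formula formula n =
    ι⁻¹-*-cancel (K.fromℕ (n !)) _ _ (fromℕ-!-nonzero n) (trans (formula n) (powμ-X⊛expS n))

corollary3p5 : ∀ {c ℓ a ℓa} (K : CharZeroField c ℓ) (𝒜 : Algebra K a ℓa) →
  let module K = CharZeroField K
      open FieldOps K
      open Algebra 𝒜
      open Series 𝒜
  in (A B : Carrier) (lam ε : K.Carrier) →
     ¬ (lam K.≈ K.0#) → ¬ (ε K.≈ K.0#) →
     let -- (i)  [B,A] = ε A - λ A²
         cond1 = (B * A - A * B) ≈ (ι ε * A - ι lam * (A * A))
         -- first double sum in (ii)
         S1 = λ (n : ℕ) → sumTo n (λ k →
                ι (K.fromℕ (n C k)) *
                (sumTo k (λ j →
                   ι (K.fromℕ (stirling2 k j) K.* K.pow ε (k ∸ j) K.* bracket lam j)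
                   * pow A j)
                 * pow B (n ∸ k)))
         -- second double sum in (ii)
         S2 = λ (n : ℕ) → sumTo n (λ k →
                ι (K.pow ε (n ∸ k)) *
                sumTo k (λ j →
                   ι (K.fromℕ (n C j) K.* K.fromℕ (stirling2 (n ∸ j) (k ∸ j))
                      K.* bracket lam (k ∸ j))
                   * pow A (k ∸ j) * pow B j))
         -- (ii)
         cond2 = ∀ (n : ℕ) → (pow (A + B) n ≈ S1 n) × (pow (A + B) n ≈ S2 n)
         -- e^{εt} - 1, as a series in 𝒜[[t]]
         Y = liftS (expK ε) ⊖ constS 1#
         -- X = 1 + λ A (e^{εt} - 1) / ε
         X = constS 1# ⊕ ((constS (ι lam * A) ⊛ Y) ⊛ constS (ι (ε K.⁻¹)))
         -- (iii)  e^{(A+B)t} = X^{1/λ} e^{Bt}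
         cond3 = expS (A + B) ≋ (powμ X (lam K.⁻¹) ⊛ expS B)
     in (cond1 ⇔ cond2) × (cond1 ⇔ cond3)
corollary3p5 K 𝒜 A B lam ε lam≉0 ε≉0 =
  mk⇔ (λ commutator n → let expansion = UnderRelation.binomialExpansion commutator n
                         in expansion , trans expansion (binomialSum≈stirlingSum n))
      (λ cond2 → commutator-from-square (proj₁ (cond2 2))) ,
  mk⇔ (λ commutator → expS-formula (UnderRelation.binomialExpansion commutator))
      (λ cond3 → commutator-from-square (expansion-from-expS-formula cond3 2))
  where
  open Algebra 𝒜 using (trans)
  open Expansion 𝒜 A B lam ε
  open ExponentialFormula 𝒜 A B lam ε lam≉0 ε≉0
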